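{- Let $a,b,c$ be pairwise coprime positive integers with $a<b<c$ and $a\mid b+c$, let $S=\langle a,b,c\rangle$, and let $k_1$ be the least positive integer with $k_1 b\in\langle a,c\rangle$. For $i\in\{1,\ldots,a\}$ and $j\geq 1$ define \[d_{i,j}=\begin{cases} c(a+1-k_1-i)+a(j-1) & 1\leq i\leq a-k_1,\\ a(j-1) & i=a-k_1+1,\\ b(i+k_1-a-1)+a(j-1) & a-k_1+2\leq i\leq a,\end{cases}\] and for an ideal $I$ of $S$ and $k\in\{1,\ldots,a\}$ let $d_k(I)=|\{d_{k,j}: j\geq 1\}\setminus I|$. Then for every ideal $I$ of $S$, \[d_1(I)\leq d_2(I)\leq\cdots\leq d_{a-k_1+1}(I)\quad\text{and}\quad d_a(I)\leq d_{a-1}(I)\leq\cdots\leq d_{a-k_1+1}(I).\]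
   Context: $\langle a_1,\ldots,a_r\rangle$ denotes the set of non-negative integer combinations of $a_1,\ldots,a_r$. A non-empty set $I\subseteq S$ is an ideal of $S$ if $I+S\subseteq I$. -}

module Defs where

open import Data.Nat using (ℕ; zero; suc; _+_; _*_; _∸_; _≤_; _<_; _≤ᵇ_; _≡ᵇ_)
open import Data.Bool using (if_then_else_)
open import Data.Product using (Σ; ∃; _×_; _,_)
open import Data.List using (List; length)
open import Data.List.Membership.Propositional using (_∈_)
open import Data.List.Relation.Unary.Unique.Propositional using (Unique)
open import Relation.Binary.PropositionalEquality using (_≡_)
open import Relation.Nullary using (¬_)

In3 : ℕ → ℕ → ℕ → ℕ → Set
In3 a b c x = ∃ λ u → ∃ λ v → ∃ λ w → x ≡ u * a + v * b + w * c

In2 : ℕ → ℕ → ℕ → Set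
In2 a c x = ∃ λ u → ∃ λ w → x ≡ u * a + w * c

IsIdeal : ℕ → ℕ → ℕ → (ℕ → Set) → Set
IsIdeal a b c I =
  (∃ λ x → I x) ×
  (∀ x → I x → In3 a b c x) ×
  (∀ x s → I x → In3 a b c s → I (x + s))

IsK1 : ℕ → ℕ → ℕ → ℕ → Set
IsK1 a b c k1 =
  1 ≤ k1 × In2 a c (k1 * b) × (∀ k → 1 ≤ k → In2 a c (k * b) → k1 ≤ k)

-- d_{i,j} (meaningful for 1 ≤ i ≤ a, j ≥ 1)
d : ℕ → ℕ → ℕ → ℕ → ℕ → ℕ → ℕ
d a b c k1 i j =
  if i ≤ᵇ (a ∸ k1) then c * ((a + 1) ∸ (k1 + i)) + a * (j ∸ 1)
  else if i ≡ᵇ (a ∸ k1 + 1) then a * (j ∸ 1)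
  else b * ((i + k1) ∸ (a + 1)) + a * (j ∸ 1)

DSet : ℕ → ℕ → ℕ → ℕ → (ℕ → Set) → ℕ → ℕ → Set
DSet a b c k1 I k x = (∃ λ j → 1 ≤ j × x ≡ d a b c k1 k j) × ¬ I x

HasCard : (ℕ → Set) → ℕ → Set
HasCard P n = ∃ λ (xs : List ℕ) →
  Unique xs × length xs ≡ n × (∀ x → (P x → x ∈ xs) × (x ∈ xs → P x))

dk≡ : ℕ → ℕ → ℕ → ℕ → (ℕ → Set) → ℕ → ℕ → Set
dk≡ a b c k1 I k n = HasCard (DSet a b c k1 I k) n

-- Moving one index towards the middle a − k₁ + 1 lowers every d_{k,j} by the
-- same generator: d_{k,j} = d_{k+1,j} + c on the left of the middle and
-- d_{k+1,j} = d_{k,j} + b on the right of it.  Since I + S ⊆ I, if x ∉ I and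
-- x = y + s with s ∈ S, then y ∉ I; so x ↦ x − c (resp. x − b) injects the
-- gaps counted by the outer index into those counted by the inner one.
module Submission where

open import Defs
open import Data.Nat using (ℕ; suc; _+_; _∸_; _≤_; _<_)
open import Data.Nat.Divisibility using (_∣_)
open import Data.Nat.Coprimality using (Coprime)
open import Data.Product using (_×_)

open import Data.Nat using (_*_; _≤ᵇ_; _≡ᵇ_; z≤n; s≤s; z<s)
open import Data.Nat.Properties
open import Data.Bool using (true; false; T)
open import Data.Product using (∃; _,_; proj₁; proj₂)
open import Data.Sum using (inj₁; inj₂)
open import Data.List using (List; []; _∷_; _++_; map; length)
open import Data.List.Properties using (length-map; length-++-sucʳ)
open import Data.List.Membership.Propositional using (_∈_)
open import Data.List.Membership.Propositional.Properties using (∈-∃++; ∈-++⁻; ∈-++⁺ˡ; ∈-++⁺ʳ; ∈-map⁺)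
open import Data.List.Relation.Binary.Subset.Propositional using (_⊆_)
open import Data.List.Relation.Unary.Any using (here; there)
open import Data.List.Relation.Unary.All as All using ()
open import Data.List.Relation.Unary.AllPairs using (_∷_)
open import Data.List.Relation.Unary.Unique.Propositional using (Unique)
open import Relation.Binary.PropositionalEquality
open import Relation.Nullary using (¬_; contradiction; yes; no)
open import Relation.Nullary.Reflects using (ofʸ; ofⁿ)

Unique∧⊆⇒length≤ : {xs ys : List ℕ} → Unique xs → xs ⊆ ys → length xs ≤ length ys
Unique∧⊆⇒length≤ {[]} _ _ = z≤n
Unique∧⊆⇒length≤ {x ∷ xs} (x∉xs ∷ xs!) xs⊆ys with ∈-∃++ (xs⊆ys (here refl))
... | ys₁ , ys₂ , refl = begin
  suc (length xs)           ≤⟨ s≤s (Unique∧⊆⇒length≤ xs! xs⊆ys₁++ys₂) ⟩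
  suc (length (ys₁ ++ ys₂)) ≡⟨ length-++-sucʳ ys₁ x ys₂ ⟨
  length (ys₁ ++ x ∷ ys₂)   ∎
  where
  open ≤-Reasoning
  xs⊆ys₁++ys₂ : xs ⊆ ys₁ ++ ys₂
  xs⊆ys₁++ys₂ y∈xs with ∈-++⁻ ys₁ (xs⊆ys (there y∈xs))
  ... | inj₁ y∈ys₁        = ∈-++⁺ˡ y∈ys₁
  ... | inj₂ (here y≡x)   = contradiction (sym y≡x) (All.lookup x∉xs y∈xs)
  ... | inj₂ (there y∈ys₂) = ∈-++⁺ʳ ys₁ y∈ys₂

HasCard-mono-image : {P Q : ℕ → Set} {m n : ℕ} (f : ℕ → ℕ) →
  (∀ x → P x → ∃ λ y → Q y × x ≡ f y) → HasCard P m → HasCard Q n → m ≤ n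
HasCard-mono-image f P⊆fQ (xs , xs! , refl , xs≈P) (ys , _ , refl , ys≈Q) =
  ≤-trans (Unique∧⊆⇒length≤ xs! xs⊆fys) (≤-reflexive (length-map f ys))
  where
  xs⊆fys : xs ⊆ map f ys
  xs⊆fys {x} x∈xs with P⊆fQ x (proj₂ (xs≈P x) x∈xs)
  ... | y , Qy , refl = ∈-map⁺ f (proj₁ (ys≈Q y) Qy)

module _ {a b c : ℕ} {I : ℕ → Set} (ideal : IsIdeal a b c I) where

  ∉-ideal-downward : ∀ {x s} → In3 a b c s → ¬ I (x + s) → ¬ I x
  ∉-ideal-downward {x} {s} s∈S x+s∉I x∈I = x+s∉I (proj₂ (proj₂ ideal) x s x∈I s∈S)

  dk-mono-shift : ∀ k1 K K' {m n} e → In3 a b c e →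
    (∀ j → d a b c k1 K j ≡ d a b c k1 K' j + e) →
    dk≡ a b c k1 I K m → dk≡ a b c k1 I K' n → m ≤ n
  dk-mono-shift k1 K K' e e∈S shift = HasCard-mono-image (_+ e) gap-shift
    where
    gap-shift : ∀ x → DSet a b c k1 I K x → ∃ λ y → DSet a b c k1 I K' y × x ≡ y + e
    gap-shift x ((j , 1≤j , refl) , x∉I) =
      d a b c k1 K' j , ((j , 1≤j , refl) , y∉I) , shift j
      where
      y∉I : ¬ I (d a b c k1 K' j)
      y∉I = ∉-ideal-downward e∈S (subst (λ z → ¬ I z) (shift j) x∉I)

m*[1+n]+o≡m*n+o+m : ∀ m n o → m * suc n + o ≡ m * n + o + m
m*[1+n]+o≡m*n+o+m m n o = begin
  m * suc n + o    ≡⟨ cong (_+ o) (*-suc m n) ⟩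
  m + m * n + o    ≡⟨ +-assoc m (m * n) o ⟩
  m + (m * n + o)  ≡⟨ +-comm m (m * n + o) ⟩
  m * n + o + m    ∎
  where open ≡-Reasoning

IsK1⇒k1≤a : ∀ {a b c k1} → 0 < a → IsK1 a b c k1 → k1 ≤ a
IsK1⇒k1≤a {a} {b} 0<a (_ , _ , least) =
  least a 0<a (b , 0 , trans (*-comm a b) (sym (+-identityʳ (b * a))))

module _ (a b c k1 : ℕ) where

  private
    p : ℕ
    p = a ∸ k1 + 1

    A : ℕ → ℕ
    A j = a * (j ∸ 1)

  d-case₁ : ∀ {i} j → i ≤ a ∸ k1 → d a b c k1 i j ≡ c * ((a + 1) ∸ (k1 + i)) + A j
  d-case₁ {i} j i≤ with i ≤ᵇ (a ∸ k1) | ≤ᵇ-reflects-≤ i (a ∸ k1)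
  ... | true  | _       = refl
  ... | false | ofⁿ i≰ = contradiction i≤ i≰

  d-case₂ : ∀ j → d a b c k1 p j ≡ A j
  d-case₂ j with p ≤ᵇ (a ∸ k1) | ≤ᵇ-reflects-≤ p (a ∸ k1)
  ... | true  | ofʸ p≤ = contradiction (≤-trans (≤-reflexive (+-comm 1 (a ∸ k1))) p≤) (n≮n (a ∸ k1))
  ... | false | _ with p ≡ᵇ p | ≡⇒≡ᵇ p p refl
  ...   | true  | _  = refl
  ...   | false | ()

  d-case₃ : ∀ {i} j → p < i → d a b c k1 i j ≡ b * ((i + k1) ∸ (a + 1)) + A j
  d-case₃ {i} j p<i with i ≤ᵇ (a ∸ k1) | ≤ᵇ-reflects-≤ i (a ∸ k1)
  ... | true  | ofʸ i≤ = contradiction (<-trans (m<m+n (a ∸ k1) z<s) p<i) (≤⇒≯ i≤)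
  ... | false | _ with i ≡ᵇ p in i≡ᵇp
  ...   | true  = contradiction (≡ᵇ⇒≡ i p (subst T (sym i≡ᵇp) _)) (>⇒≢ p<i)
  ...   | false = refl

  a+1≡k1+p : k1 ≤ a → a + 1 ≡ k1 + p
  a+1≡k1+p k1≤a = begin
    a + 1              ≡⟨ cong (_+ 1) (m+[n∸m]≡n k1≤a) ⟨
    k1 + (a ∸ k1) + 1  ≡⟨ +-assoc k1 (a ∸ k1) 1 ⟩
    k1 + p             ∎
    where open ≡-Reasoning

  private
    e*[p∸p]+A≡A : ∀ e j → e * (p ∸ p) + A j ≡ A j
    e*[p∸p]+A≡A e j = cong (_+ A j) (trans (cong (e *_) (n∸n≡0 p)) (*-zeroʳ e))

  d-left : k1 ≤ a → ∀ {i} j → i ≤ p → d a b c k1 i j ≡ c * (p ∸ i) + A j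
  d-left k1≤a {i} j i≤p with i ≤? a ∸ k1
  ... | yes i≤ = begin
    d a b c k1 i j                      ≡⟨ d-case₁ j i≤ ⟩
    c * ((a + 1) ∸ (k1 + i)) + A j      ≡⟨ cong (λ t → c * (t ∸ (k1 + i)) + A j) (a+1≡k1+p k1≤a) ⟩
    c * ((k1 + p) ∸ (k1 + i)) + A j     ≡⟨ cong (λ t → c * t + A j) ([m+n]∸[m+o]≡n∸o k1 p i) ⟩
    c * (p ∸ i) + A j                   ∎
    where open ≡-Reasoning
  ... | no i≰ with refl ← ≤-antisym i≤p (≤-trans (≤-reflexive (+-comm (a ∸ k1) 1)) (≰⇒> i≰)) =
    trans (d-case₂ j) (sym (e*[p∸p]+A≡A c j))

  d-right : k1 ≤ a → ∀ {i} j → p ≤ i → d a b c k1 i j ≡ b * (i ∸ p) + A j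
  d-right k1≤a {i} j p≤i with m≤n⇒m<n∨m≡n p≤i
  ... | inj₁ p<i = begin
    d a b c k1 i j                      ≡⟨ d-case₃ j p<i ⟩
    b * ((i + k1) ∸ (a + 1)) + A j      ≡⟨ cong₂ (λ s t → b * (s ∸ t) + A j) (+-comm i k1) (a+1≡k1+p k1≤a) ⟩
    b * ((k1 + i) ∸ (k1 + p)) + A j     ≡⟨ cong (λ t → b * t + A j) ([m+n]∸[m+o]≡n∸o k1 i p) ⟩
    b * (i ∸ p) + A j                   ∎
    where open ≡-Reasoning
  ... | inj₂ refl = trans (d-case₂ j) (sym (e*[p∸p]+A≡A b j))

  d-step-left : k1 ≤ a → ∀ {k} j → suc k ≤ p → d a b c k1 k j ≡ d a b c k1 (suc k) j + c
  d-step-left k1≤a {k} j 1+k≤p = begin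
    d a b c k1 k j                 ≡⟨ d-left k1≤a j (≤-trans (n≤1+n k) 1+k≤p) ⟩
    c * (p ∸ k) + A j              ≡⟨ cong (λ t → c * t + A j) (+-∸-assoc 1 1+k≤p) ⟩
    c * suc (p ∸ suc k) + A j      ≡⟨ m*[1+n]+o≡m*n+o+m c (p ∸ suc k) (A j) ⟩
    c * (p ∸ suc k) + A j + c      ≡⟨ cong (_+ c) (d-left k1≤a j 1+k≤p) ⟨
    d a b c k1 (suc k) j + c       ∎
    where open ≡-Reasoning

  d-step-right : k1 ≤ a → ∀ {k} j → p ≤ k → d a b c k1 (suc k) j ≡ d a b c k1 k j + b
  d-step-right k1≤a {k} j p≤k = begin
    d a b c k1 (suc k) j           ≡⟨ d-right k1≤a j (≤-trans p≤k (n≤1+n k)) ⟩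
    b * (suc k ∸ p) + A j          ≡⟨ cong (λ t → b * t + A j) (+-∸-assoc 1 p≤k) ⟩
    b * suc (k ∸ p) + A j          ≡⟨ m*[1+n]+o≡m*n+o+m b (k ∸ p) (A j) ⟩
    b * (k ∸ p) + A j + b          ≡⟨ cong (_+ b) (d-right k1≤a j p≤k) ⟨
    d a b c k1 k j + b             ∎
    where open ≡-Reasoning

proposition4p2 : (a b c k1 : ℕ) → 0 < a → a < b → b < c →
    Coprime a b → Coprime a c → Coprime b c → a ∣ b + c →
    IsK1 a b c k1 →
    (I : ℕ → Set) → IsIdeal a b c I →
    (∀ k m n → 1 ≤ k → suc k ≤ a ∸ k1 + 1 →
      dk≡ a b c k1 I k m → dk≡ a b c k1 I (suc k) n → m ≤ n)
    ×
    (∀ k m n → a ∸ k1 + 1 ≤ k → suc k ≤ a →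
      dk≡ a b c k1 I (suc k) m → dk≡ a b c k1 I k n → m ≤ n)
proposition4p2 a b c k1 0<a _ _ _ _ _ _ isK1 I ideal = left-chain , right-chain
  where
  k1≤a : k1 ≤ a
  k1≤a = IsK1⇒k1≤a 0<a isK1

  c∈S : In3 a b c c
  c∈S = 0 , 0 , 1 , sym (+-identityʳ c)

  b∈S : In3 a b c b
  b∈S = 0 , 1 , 0 , sym (trans (+-identityʳ (b + 0)) (+-identityʳ b))

  left-chain : ∀ k m n → 1 ≤ k → suc k ≤ a ∸ k1 + 1 →
    dk≡ a b c k1 I k m → dk≡ a b c k1 I (suc k) n → m ≤ n
  left-chain k m n _ 1+k≤p =
    dk-mono-shift ideal k1 k (suc k) c c∈S (λ j → d-step-left a b c k1 k1≤a j 1+k≤p)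

  right-chain : ∀ k m n → a ∸ k1 + 1 ≤ k → suc k ≤ a →
    dk≡ a b c k1 I (suc k) m → dk≡ a b c k1 I k n → m ≤ n
  right-chain k m n p≤k _ =
    dk-mono-shift ideal k1 (suc k) k b b∈S (λ j → d-step-right a b c k1 k1≤a j p≤k)
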